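{- Every function in the support of $\mathcal D_{\mathrm{yes}}$ is monotone.
   Context: $n$ is divisible by $4$, $\|x\|_1$ is Hamming weight, and $L:=(4/3)^n$. A term is a map $T_i:[n]\to[n]$, identified with the Boolean function $T_i(x)=\bigwedge_{k\in[n]}x_{T_i(k)}$. For a tuple $T=(T_i:i\in[L])$ define $\Gamma_T:\{0,1\}^n\to[L]\cup\{0^*,1^*\}$ by $\Gamma_T(x)=0^*$ if $T_i(x)=0$ for all $i$, $\Gamma_T(x)=1^*$ if $T_i(x)=1$ for at least two distinct $i$, and $\Gamma_T(x)=i$ if $T_i$ is the unique term with $T_i(x)=1$. A draw $f\sim\mathcal D_{\mathrm{yes}}$: choose each $T_i(k)$ independently uniformly from $[n]$; independently choose $H=(h_i:i\in[L])$ where each $h_i$ is independently, with probability $2/3$, a dictator $h_i(x)=x_k$ with $k$ uniform in $[n]$, and with probability $1/3$ the constant-$0$ function; then $f(x)=1$ if $\|x\|_1>3n/4+1$, $f(x)=0$ if $\|x\|_1<3n/4$, and for $\|x\|_1\in\{3n/4,3n/4+1\}$: $f(x)=0$ if $\Gamma_T(x)=0^*$, $f(x)=1$ if $\Gamma_T(x)=1^*$, and $f(x)=h_{\Gamma_T(x)}(x)$ otherwise. Monotone means $x\preceq y$ coordinatewise implies $f(x)\le f(y)$. -}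

module Defs where

open import Data.Nat using (ℕ; _+_; _*_; _^_; _<_; _>_; _≤_)
open import Data.Nat.Properties using (m^n≢0; _<?_)
open import Data.Nat.DivMod using (_/_)
open import Data.Bool using (Bool; true; false; if_then_else_; _∧_; T?) renaming (_≤_ to _B≤_)
open import Data.Fin using (Fin)
open import Data.List using (List; []; _∷_; filter; map; foldr; allFin)
open import Data.Nat.ListAction using (sum)
open import Relation.Nullary.Decidable using (does)
open import Relation.Binary.PropositionalEquality using (_≡_)

-- L = (4/3)^n, read as the integer ⌊4^n / 3^n⌋
numTerms : ℕ → ℕ
numTerms n = _/_ (4 ^ n) (3 ^ n) {{m^n≢0 3 n}}

Point : ℕ → Set
Point n = Fin n → Bool

boolToℕ : Bool → ℕ
boolToℕ true  = 1
boolToℕ false = 0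

weight : ∀ {n} → Point n → ℕ
weight {n} x = sum (map (λ k → boolToℕ (x k)) (allFin n))

-- a term T : [n] → [n], as the Boolean function ⋀_k x_{T(k)}
Term : ℕ → Set
Term n = Fin n → Fin n

evalTerm : ∀ {n} → Term n → Point n → Bool
evalTerm {n} t x = foldr _∧_ true (map (λ k → x (t k)) (allFin n))

data HFun (n : ℕ) : Set where
  dictator : Fin n → HFun n
  const0   : HFun n

evalH : ∀ {n} → HFun n → Point n → Bool
evalH (dictator k) x = x k
evalH const0       x = false

data GammaVal (L : ℕ) : Set where
  zeroStar : GammaVal L
  oneStar  : GammaVal L
  unique   : Fin L → GammaVal L

classify : ∀ {L} → List (Fin L) → GammaVal L
classify []            = zeroStar
classify (i ∷ [])      = unique i
classify (_ ∷ _ ∷ _)   = oneStar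

Gamma : ∀ {n L} → (Fin L → Term n) → Point n → GammaVal L
Gamma {n} {L} T x = classify (filter (λ i → T? (evalTerm (T i) x)) (allFin L))

fYes : ∀ {n} → (Fin (numTerms n) → Term n) → (Fin (numTerms n) → HFun n)
     → Point n → Bool
fYes {n} T H x =
  if does (3 * n / 4 + 1 <? weight x) then true
  else if does (weight x <? 3 * n / 4) then false
  else mid (Gamma T x)
  where
    mid : GammaVal (numTerms n) → Bool
    mid zeroStar   = false
    mid oneStar    = true
    mid (unique i) = evalH (H i) x

Monotone : ∀ {n} → (Point n → Bool) → Set
Monotone {n} f = ∀ (x y : Point n) → (∀ k → x k B≤ y k) → f x B≤ f y

-- Outside the two middle layers f is a threshold in the Hamming weight, which is monotone.
-- On the middle layers, raising coordinates can only make more terms fire, so Γ_T moves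
-- from 0* to anything, or from a unique index i to i or to 1*; since each h_i is monotone
-- and 0* ↦ 0, 1* ↦ 1, the value of f can only grow. Comparisons across layers are
-- handled by the thresholds.
module Submission where

open import Defs
open import Data.Nat using (ℕ; _+_; _*_; _/_; z≤n) renaming (_≤_ to _≤ℕ_)
open import Data.Nat.Divisibility using (_∣_)
open import Data.Nat.Properties using (_<?_; ≤-refl; +-mono-≤; <-≤-trans; ≤-<-trans)
open import Data.Nat.ListAction using (sum)
open import Data.Fin using (Fin)
open import Data.Bool using (Bool; true; false; T; T?; _∧_; if_then_else_; _≤_; f≤t; b≤b)
open import Data.Bool.Properties using (≤-minimum; ≤-maximum)
open import Data.List using (List; []; _∷_; map; allFin)
open import Data.Bool.ListAction using (all)
open import Data.List.Relation.Binary.Sublist.Propositional using (_⊆_; _∷_; _∷ʳ_; []; ⊆-refl)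
open import Data.List.Relation.Binary.Sublist.Propositional.Properties using (filter⁺)
open import Relation.Nullary using (Dec; yes; no; does; contradiction)
open import Relation.Binary.PropositionalEquality using (_≡_; refl; sym; subst₂)

∧-mono : ∀ {a b c d} → a ≤ b → c ≤ d → a ∧ c ≤ b ∧ d
∧-mono {d = d} f≤t _   = ≤-minimum d
∧-mono {false} b≤b _   = b≤b
∧-mono {true}  b≤b c≤d = c≤d

T-mono : ∀ {a b} → a ≤ b → T a → T b
T-mono b≤b t = t

does-mono : ∀ {p q} {P : Set p} {Q : Set q} → (P → Q) → (P? : Dec P) (Q? : Dec Q) → does P? ≤ does Q?
does-mono _   (yes _) (yes _) = b≤b
does-mono P⇒Q (yes p) (no ¬q) = contradiction (P⇒Q p) ¬q
does-mono _   (no _)  Q?      = ≤-minimum (does Q?)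

all-mono : ∀ {A : Set} {f g : A → Bool} → (∀ a → f a ≤ g a) → ∀ xs → all f xs ≤ all g xs
all-mono f≤g []       = b≤b
all-mono f≤g (x ∷ xs) = ∧-mono (f≤g x) (all-mono f≤g xs)

sum-map-mono : ∀ {A : Set} {f g : A → ℕ} → (∀ a → f a ≤ℕ g a) → ∀ xs → sum (map f xs) ≤ℕ sum (map g xs)
sum-map-mono f≤g []       = z≤n
sum-map-mono f≤g (x ∷ xs) = +-mono-≤ (f≤g x) (sum-map-mono f≤g xs)

boolToℕ-mono : ∀ {a b} → a ≤ b → boolToℕ a ≤ℕ boolToℕ b
boolToℕ-mono f≤t = z≤n
boolToℕ-mono b≤b = ≤-refl

clamp : (above below : Bool) → Bool → Bool
clamp above below b = if above then true else if below then false else b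

clamp-mono : ∀ {a a′ c c′ b b′} → a ≤ a′ → c′ ≤ c → b ≤ b′ → clamp a c b ≤ clamp a′ c′ b′
clamp-mono {a′ = true}              _   _   _    = ≤-maximum _
clamp-mono {a′ = false} {c = true}  b≤b _   _    = ≤-minimum _
clamp-mono {a′ = false} {c = false} b≤b b≤b b≤b′ = b≤b′

_≼_ : ∀ {n} → Point n → Point n → Set
x ≼ y = ∀ k → x k ≤ y k

weight-mono : ∀ {n} {x y : Point n} → x ≼ y → weight x ≤ℕ weight y
weight-mono {n} x≼y = sum-map-mono (λ k → boolToℕ-mono (x≼y k)) (allFin n)

evalTerm-mono : ∀ {n} (t : Term n) {x y : Point n} → x ≼ y → evalTerm t x ≤ evalTerm t y
evalTerm-mono {n} t x≼y = all-mono (λ k → x≼y (t k)) (allFin n)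

evalH-mono : ∀ {n} (h : HFun n) {x y : Point n} → x ≼ y → evalH h x ≤ evalH h y
evalH-mono (dictator k) x≼y = x≼y k
evalH-mono const0       _   = b≤b

infix 4 _⊑_

data _⊑_ {L : ℕ} : GammaVal L → GammaVal L → Set where
  zeroStar⊑       : ∀ g → zeroStar ⊑ g
  oneStar⊑oneStar : oneStar ⊑ oneStar
  unique⊑unique   : ∀ i → unique i ⊑ unique i
  unique⊑oneStar  : ∀ i → unique i ⊑ oneStar

classify-⊆ : ∀ {L} {is js : List (Fin L)} → is ⊆ js → classify is ⊑ classify js
classify-⊆ {is = []}                         _           = zeroStar⊑ _
classify-⊆ {is = i ∷ []}    {js = _ ∷ []}    (refl ∷ []) = unique⊑unique i
classify-⊆ {is = i ∷ []}    {js = _ ∷ []}    (_ ∷ʳ ())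
classify-⊆ {is = i ∷ []}    {js = _ ∷ _ ∷ _} _           = unique⊑oneStar i
classify-⊆ {is = _ ∷ _ ∷ _} {js = _ ∷ []}    (_ ∷ ())
classify-⊆ {is = _ ∷ _ ∷ _} {js = _ ∷ []}    (_ ∷ʳ ())
classify-⊆ {is = _ ∷ _ ∷ _} {js = _ ∷ _ ∷ _} _           = oneStar⊑oneStar

Gamma-mono : ∀ {n L} (terms : Fin L → Term n) {x y : Point n} → x ≼ y → Gamma terms x ⊑ Gamma terms y
Gamma-mono {L = L} terms {x} {y} x≼y =
  classify-⊆ (filter⁺ (fires x) (fires y) fires-mono (⊆-refl {x = allFin L}))
  where
    fires : (z : Point _) (i : Fin L) → Dec (T (evalTerm (terms i) z))
    fires z i = T? (evalTerm (terms i) z)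

    fires-mono : ∀ {i j} → i ≡ j → T (evalTerm (terms i) x) → T (evalTerm (terms j) y)
    fires-mono {i} refl = T-mono (evalTerm-mono (terms i) x≼y)

middleLayer : ∀ {n L} → (Fin L → HFun n) → Point n → GammaVal L → Bool
middleLayer H x zeroStar   = false
middleLayer H x oneStar    = true
middleLayer H x (unique i) = evalH (H i) x

middleLayer-mono : ∀ {n L} (H : Fin L → HFun n) {x y : Point n} {g g′ : GammaVal L} →
                   x ≼ y → g ⊑ g′ → middleLayer H x g ≤ middleLayer H y g′
middleLayer-mono H x≼y (zeroStar⊑ _)      = ≤-minimum _
middleLayer-mono H x≼y oneStar⊑oneStar    = b≤b
middleLayer-mono H x≼y (unique⊑unique i)  = evalH-mono (H i) x≼y
middleLayer-mono H x≼y (unique⊑oneStar i) = ≤-maximum _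

-- middleLayer is a top-level copy of the local function mid in the definition of fYes.
fYes≡clamp : ∀ {n} (T : Fin (numTerms n) → Term n) (H : Fin (numTerms n) → HFun n) (x : Point n) →
             fYes T H x ≡ clamp (does (3 * n / 4 + 1 <? weight x)) (does (weight x <? 3 * n / 4))
                                (middleLayer H x (Gamma T x))
fYes≡clamp T H x with Gamma T x
... | zeroStar = refl
... | oneStar  = refl
... | unique i = refl

lemma5p4 : (n : ℕ) → 4 ∣ n → (T : Fin (numTerms n) → Term n) → (H : Fin (numTerms n) → HFun n) → Monotone (fYes T H)
lemma5p4 n _ T H x y x≼y =
  subst₂ _≤_ (sym (fYes≡clamp T H x)) (sym (fYes≡clamp T H y))
    (clamp-mono (does-mono (λ hi<wx → <-≤-trans hi<wx wx≤wy) (3 * n / 4 + 1 <? weight x) (3 * n / 4 + 1 <? weight y))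
                (does-mono (≤-<-trans wx≤wy) (weight y <? 3 * n / 4) (weight x <? 3 * n / 4))
                (middleLayer-mono H x≼y (Gamma-mono T x≼y)))
  where
    wx≤wy : weight x ≤ℕ weight y
    wx≤wy = weight-mono x≼y
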